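{- Let $\mathcal{B}$ be the set of all triples $B=(U,V,E)$ such that $U$ and $V$ are disjoint, the graph $(U\cup V,E)$ is VC-irreducible, and $U$ is a minimum vertex cover of $(U\cup V,E)$. Let $\ell,m,n\in\mathbb{N}$. Then the set of graphs $(U'\cup V',E')$ with $(U',V',E')$ in the range of $\mathcal{G}^3_m(\mathcal{G}^2_n(C(\mathcal{G}^1_{\mathcal{B},\ell,m,n})))$ is (up to renaming vertices) exactly the set of all graphs with $n$ vertices, $m$ edges and minimum vertex cover size $\ell$.
   Context: Graphs are finite, simple, undirected; a vertex cover is a set of vertices meeting every edge. A connected graph $G=(V,E)$ is VC-irreducible if for every edge $e\in E$, the graph $(V,E\setminus\{e\})$ has strictly smaller minimum vertex cover size than $G$ (a single vertex with no edges counts as VC-irreducible). The processes: (1) $\mathcal{G}^1_{\mathcal{B},\ell,m,n}$ outputs, uniformly at random, a collection $S_1,\dots,S_k$ of elements of $\mathcal{B}$ (elements may repeat, taken as pairwise vertex-disjoint copies) with $S_i=(U_i,V_i,E_i)$, $|\bigcup_i U_i|=\ell$, $|\bigcup_i V_i|+\ell\le n$, $|\bigcup_i E_i|\le m$; and $C(S_1,\dots,S_k)=(\bigcup_i U_i,\bigcup_i V_i,\bigcup_i E_i)$. (2) For $B=(U,V,E)$ with $|U|+|V|\le n$, $\mathcal{G}^2_n(B)=(U,V\cup V',E)$ with $V'$ a set of $n-|U|-|V|$ new vertices. (3) For $B=(U,V,E)$ with $|E|\le m$, $\mathcal{G}^3_m(B)$ adds uniformly at random $m-|E|$ new edges each joining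 a vertex of $U$ with a vertex of $U\cup V$. -}

module Defs where

open import Data.Nat using (ℕ; zero; suc; _+_; _∸_; _≤_; _<_; _<ᵇ_)
open import Data.Bool using (Bool; true; false; _∧_; _∨_; not; if_then_else_)
open import Data.Fin using (Fin; toℕ; splitAt; _≟_)
open import Data.Fin.Subset using (Subset; _∈_; ∣_∣)
open import Data.List using (List; []; _∷_; foldr; map; allFin)
open import Data.Nat.ListAction using (sum)
open import Data.List.Relation.Unary.All using (All)
open import Data.Product using (Σ; Σ-syntax; ∃; ∃-syntax; _×_; _,_)
open import Data.Sum using (_⊎_; inj₁; inj₂)
open import Data.Vec using (tabulate)
open import Function.Bundles using (_↔_; Inverse)
open import Relation.Nullary.Decidable using (⌊_⌋)
open import Relation.Binary.PropositionalEquality using (_≡_)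

record Graph : Set where
  constructor mkGraph
  field
    size : ℕ
    adj  : Fin size → Fin size → Bool
open Graph public

Simple : Graph → Set
Simple G = (∀ i j → adj G i j ≡ adj G j i) × (∀ i → adj G i i ≡ false)

count : {A : Set} → (A → Bool) → List A → ℕ
count p xs = sum (map (λ x → if p x then 1 else 0) xs)

edgeCount : Graph → ℕ
edgeCount G =
  sum (map (λ i → count (λ j → (toℕ i <ᵇ toℕ j) ∧ adj G i j) (allFin (size G)))
           (allFin (size G)))

IsVC : (G : Graph) → Subset (size G) → Set
IsVC G S = ∀ i j → adj G i j ≡ true → (i ∈ S) ⊎ (j ∈ S)

IsMinVC : (G : Graph) → Subset (size G) → Set
IsMinVC G S = IsVC G S × (∀ S′ → IsVC G S′ → ∣ S ∣ ≤ ∣ S′ ∣)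

MinVCSize : Graph → ℕ → Set
MinVCSize G k = Σ[ S ∈ Subset (size G) ] (IsMinVC G S × ∣ S ∣ ≡ k)

-- connectivity (a connected graph is nonempty)
data Path (G : Graph) : Fin (size G) → Fin (size G) → Set where
  here : ∀ {i} → Path G i i
  step : ∀ {i j k} → adj G i j ≡ true → Path G j k → Path G i k

Connected : Graph → Set
Connected G = (1 ≤ size G) × (∀ i j → Path G i j)

removeEdge : (G : Graph) → Fin (size G) → Fin (size G) → Graph
removeEdge G i j = mkGraph (size G) (λ a b →
  adj G a b ∧ not ((⌊ a ≟ i ⌋ ∧ ⌊ b ≟ j ⌋) ∨ (⌊ a ≟ j ⌋ ∧ ⌊ b ≟ i ⌋)))

VCIrreducible : Graph → Set
VCIrreducible G = Connected G ×
  (∀ i j → adj G i j ≡ true → ∀ k k′ →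
     MinVCSize G k → MinVCSize (removeEdge G i j) k′ → k′ < k)

Iso : Graph → Graph → Set
Iso G H = Σ[ f ∈ (Fin (size G) ↔ Fin (size H)) ]
  (∀ i j → adj G i j ≡ adj H (Inverse.to f i) (Inverse.to f j))

-- Triples (U, V, E): vertex set Fin size, partitioned by `side`
-- (side v = true means v ∈ U, false means v ∈ V); so U, V are disjoint
-- and U ∪ V is the whole vertex set.

record Triple : Set where
  constructor mkTriple
  field
    graph : Graph
    side  : Fin (size graph) → Bool
open Triple public

Uset : (T : Triple) → Subset (size (graph T))
Uset T = tabulate (side T)

Vset : (T : Triple) → Subset (size (graph T))
Vset T = tabulate (λ v → not (side T v))

InB : Triple → Set
InB T = Simple (graph T) × VCIrreducible (graph T) × IsMinVC (graph T) (Uset T)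

_⊕_ : Triple → Triple → Triple
mkTriple (mkGraph N₁ a₁) s₁ ⊕ mkTriple (mkGraph N₂ a₂) s₂ =
  mkTriple (mkGraph (N₁ + N₂) adj′) side′
  where
  adj′ : Fin (N₁ + N₂) → Fin (N₁ + N₂) → Bool
  adj′ x y with splitAt N₁ x | splitAt N₁ y
  ... | inj₁ x₁ | inj₁ y₁ = a₁ x₁ y₁
  ... | inj₂ x₂ | inj₂ y₂ = a₂ x₂ y₂
  ... | inj₁ _  | inj₂ _  = false
  ... | inj₂ _  | inj₁ _  = false
  side′ : Fin (N₁ + N₂) → Bool
  side′ x with splitAt N₁ x
  ... | inj₁ x₁ = s₁ x₁
  ... | inj₂ x₂ = s₂ x₂

emptyTriple : Triple
emptyTriple = mkTriple (mkGraph 0 (λ ())) (λ ())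

C : List Triple → Triple
C = foldr _⊕_ emptyTriple

G1Admissible : ℕ → ℕ → ℕ → List Triple → Set
G1Admissible ℓ m n Ss =
  All InB Ss ×
  ∣ Uset (C Ss) ∣ ≡ ℓ ×
  ∣ Vset (C Ss) ∣ + ℓ ≤ n ×
  edgeCount (graph (C Ss)) ≤ m

isolatedV : ℕ → Triple
isolatedV k = mkTriple (mkGraph k (λ _ _ → false)) (λ _ → false)

G2 : ℕ → Triple → Triple
G2 n T = T ⊕ isolatedV (n ∸ size (graph T))

G3Outcome : ℕ → Triple → Set
G3Outcome m T =
  Σ[ a ∈ (Fin (size (graph T)) → Fin (size (graph T)) → Bool) ]
    (Simple (mkGraph (size (graph T)) a) ×
     (∀ i j → adj (graph T) i j ≡ true → a i j ≡ true) ×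
     (∀ i j → a i j ≡ true → adj (graph T) i j ≡ false →
        (side T i ≡ true) ⊎ (side T j ≡ true)) ×
     edgeCount (mkGraph (size (graph T)) a) ≡ m)

G3Result : (m : ℕ) (T : Triple) → G3Outcome m T → Triple
G3Result m T (a , _) = mkTriple (mkGraph (size (graph T)) a) (side T)

InRange : ℕ → ℕ → ℕ → Graph → Set
InRange ℓ m n G =
  Σ[ Ss ∈ List Triple ] (G1Admissible ℓ m n Ss ×
    Σ[ o ∈ G3Outcome m (G2 n (C Ss)) ]
      Iso (graph (G3Result m (G2 n (C Ss)) o)) G)

{-# OPTIONS --safe #-}
-- Each triple of 𝓑 has U as a minimum vertex cover, and minimum covers of vertex-disjoint graphs
-- combine, so the U-part of C(S₁,…,S_k) is a minimum cover of size ℓ; isolated vertices and edges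
-- meeting U do not change that.
-- Conversely, let U be a minimum cover of G. Deleting edges as long as U stays a minimum cover ends
-- in a subgraph where every edge deletion lowers the cover number. In such a graph every connected
-- component is itself VC-irreducible with its share of U as a minimum cover, so it lies in 𝓑, and
-- 𝓖³ can restore the deleted edges because each of them meets U.
module Submission where

open import Defs
open import Data.Bool using (Bool; true; false; _∧_; _∨_; not; if_then_else_)
import Data.Bool.Properties as Bool
open import Data.Empty using (⊥; ⊥-elim)
open import Data.Fin using (Fin; zero; suc; toℕ; splitAt; _≟_; _↑ˡ_; _↑ʳ_)
open import Data.Fin.Permutation using (↔⇒≡)
open import Data.Fin.Properties
  using (splitAt-↑ˡ; splitAt-↑ʳ; toℕ-injective; +↔⊎; all?; any?; ¬∀⟶∃¬)
open import Data.Fin.Subset using (Subset; ∣_∣)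
open import Data.Fin.Subset.Properties using (anySubset?)
open import Data.List using (List; []; _∷_; allFin)
import Data.List as List using (map; tabulate)
open import Data.List.Relation.Unary.All using (All; []; _∷_)
open import Data.Nat using (ℕ; zero; suc; _+_; _∸_; _≤_; _<_; _<ᵇ_; z≤n; s≤s; z<s; _<?_; ⌊_/2⌋)
open import Data.Nat.Induction using (<-rec)
import Data.Nat.ListAction as ListAction
open import Data.Nat.Properties hiding (_≟_)
open import Data.Product using (∃₂; ∃-syntax; _×_; _,_; proj₁; proj₂)
open import Data.Sum using (_⊎_; inj₁; inj₂; [_,_]; map₁)
import Data.Sum
open import Data.Sum.Algebra using (⊎-comm; ⊎-cong)
open import Data.Sum.Properties using (inj₁-injective; inj₂-injective)
open import Data.Vec using (tabulate; lookup; _∷_; [])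
open import Data.Vec.Properties using (lookup∘tabulate; []=⇒lookup; lookup⇒[]=)
open import Function using (_∘_; id; case_of_)
open import Function.Bundles using (_⇔_; _↔_; Inverse; Equivalence; mk⇔; mk↔ₛ′)
open import Function.Properties.Inverse using (↔-refl; ↔-sym; ↔-trans)
open import Relation.Binary.Definitions using (tri<; tri≈; tri>)
open import Relation.Binary.PropositionalEquality hiding ([_])
open import Relation.Nullary using (Dec; yes; no; ¬_; contradiction)
open import Relation.Nullary.Decidable
  using (⌊_⌋; _×-dec_; _⊎-dec_; _→-dec_; isYes≗does; dec-true; dec-false)
open import Algebra.Properties.CommutativeMonoid.Sum +-0-commutativeMonoid
  using (sum; sum-syntax; ∑-comm; ∑-permute; ∑-distrib-+; sum-cong-≗)

<ᵇ-true : ∀ {m n} → m < n → (m <ᵇ n) ≡ true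
<ᵇ-true m<n = Equivalence.to Bool.T-≡ (<⇒<ᵇ m<n)

<ᵇ-false : ∀ {m n} → ¬ m < n → (m <ᵇ n) ≡ false
<ᵇ-false {m} {n} m≮n = Bool.¬-not (m≮n ∘ <ᵇ⇒< m n ∘ Equivalence.from Bool.T-≡)

⌊⌋-intro : ∀ {P : Set} (p? : Dec P) → P → ⌊ p? ⌋ ≡ true
⌊⌋-intro p? p = trans (isYes≗does p?) (dec-true p? p)

¬→⇒×¬ : ∀ {P Q : Set} → Dec P → ¬ (P → Q) → P × ¬ Q
¬→⇒×¬ (yes p) ¬[p→q] = p , λ q → ¬[p→q] λ _ → q
¬→⇒×¬ (no ¬p) ¬[p→q] = contradiction (λ p → contradiction p ¬p) ¬[p→q]

⌊⌋-true⇒ : ∀ {P : Set} (p? : Dec P) → ⌊ p? ⌋ ≡ true → P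
⌊⌋-true⇒ (yes p) _ = p

⌊≟⌋-refl : ∀ {n} (x : Fin n) → ⌊ x ≟ x ⌋ ≡ true
⌊≟⌋-refl x = ⌊⌋-intro (x ≟ x) refl

⌊≟⌋-≢ : ∀ {n} {x y : Fin n} → x ≢ y → ⌊ x ≟ y ⌋ ≡ false
⌊≟⌋-≢ {x = x} {y} x≢y = trans (isYes≗does (x ≟ y)) (dec-false (x ≟ y) x≢y)

⌊≟⌋-injective : ∀ {m n} {f : Fin m → Fin n} → (∀ {x y} → f x ≡ f y → x ≡ y) →
  ∀ x y → ⌊ f x ≟ f y ⌋ ≡ ⌊ x ≟ y ⌋
⌊≟⌋-injective {f = f} f-inj x y with x ≟ y
... | yes refl = ⌊≟⌋-refl (f x)
... | no x≢y = ⌊≟⌋-≢ (x≢y ∘ f-inj)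

χ : Bool → ℕ
χ b = if b then 1 else 0

card : ∀ {n} → (Fin n → Bool) → ℕ
card {n} t = ∑[ i < n ] χ (t i)

χ-mono : ∀ {x y} → (x ≡ true → y ≡ true) → χ x ≤ χ y
χ-mono {false} _ = z≤n
χ-mono {true} x⇒y rewrite x⇒y refl = ≤-refl

∑-mono-≤ : ∀ {n} {f g : Fin n → ℕ} → (∀ i → f i ≤ g i) → sum f ≤ sum g
∑-mono-≤ {zero} f≤g = z≤n
∑-mono-≤ {suc n} f≤g = +-mono-≤ (f≤g zero) (∑-mono-≤ (f≤g ∘ suc))

∑-mono-< : ∀ {n} {f g : Fin n → ℕ} → (∀ i → f i ≤ g i) → ∀ k → f k < g k → sum f < sum g
∑-mono-< {suc n} f≤g zero fk<gk = +-mono-<-≤ fk<gk (∑-mono-≤ (f≤g ∘ suc))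
∑-mono-< {suc n} f≤g (suc k) fk<gk = +-mono-≤-< (f≤g zero) (∑-mono-< (f≤g ∘ suc) k fk<gk)

∑-term : ∀ {n} (f : Fin n → ℕ) k → f k ≤ sum f
∑-term {suc n} f zero = m≤m+n _ _
∑-term {suc n} f (suc k) = ≤-trans (∑-term (f ∘ suc) k) (m≤n+m _ _)

∑-↑ : ∀ a b (f : Fin (a + b) → ℕ) → sum f ≡ ∑[ i < a ] f (i ↑ˡ b) + ∑[ j < b ] f (a ↑ʳ j)
∑-↑ zero b f = refl
∑-↑ (suc a) b f = trans (cong (f zero +_) (∑-↑ a b (f ∘ suc))) (sym (+-assoc (f zero) _ _))

list-sum-tabulate : ∀ {n} {A : Set} (f : A → ℕ) (g : Fin n → A) →
  ListAction.sum (List.map f (List.tabulate g)) ≡ ∑[ i < n ] f (g i)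
list-sum-tabulate {zero} f g = refl
list-sum-tabulate {suc n} f g = cong (f (g zero) +_) (list-sum-tabulate f (g ∘ suc))

card-mono : ∀ {n} {s t : Fin n → Bool} → (∀ i → s i ≡ true → t i ≡ true) → card s ≤ card t
card-mono s⊆t = ∑-mono-≤ (χ-mono ∘ s⊆t)

card-mono-< : ∀ {n} {s t : Fin n → Bool} → (∀ i → s i ≡ true → t i ≡ true) →
  ∀ k → s k ≡ false → t k ≡ true → card s < card t
card-mono-< s⊆t k sk tk = ∑-mono-< (χ-mono ∘ s⊆t) k (subst₂ (λ x y → χ x < χ y) (sym sk) (sym tk) ≤-refl)

card-cong : ∀ {n} {s t : Fin n → Bool} → (∀ i → s i ≡ t i) → card s ≡ card t
card-cong s≗t = sum-cong-≗ (cong χ ∘ s≗t)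

card-full : ∀ n → card {n} (λ _ → true) ≡ n
card-full zero = refl
card-full (suc n) = cong suc (card-full n)

card-empty : ∀ n → card {n} (λ _ → false) ≡ 0
card-empty zero = refl
card-empty (suc n) = card-empty n

card≤n : ∀ {n} (t : Fin n → Bool) → card t ≤ n
card≤n {n} t = subst (card t ≤_) (card-full n) (card-mono {s = t} (λ _ _ → refl))

card-complement : ∀ {n} (t : Fin n → Bool) → card t + card (not ∘ t) ≡ n
card-complement {n} t = begin
  card t + card (not ∘ t)          ≡⟨ ∑-distrib-+ (χ ∘ t) (χ ∘ not ∘ t) ⟨
  ∑[ i < n ] (χ (t i) + χ (not (t i))) ≡⟨ sum-cong-≗ (λ i → χ+χ-not (t i)) ⟩
  card {n} (λ _ → true)            ≡⟨ card-full n ⟩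
  n                                ∎
  where
  open ≡-Reasoning
  χ+χ-not : ∀ x → χ x + χ (not x) ≡ 1
  χ+χ-not false = refl
  χ+χ-not true = refl

card-permute : ∀ {m n} (π : Fin m ↔ Fin n) (t : Fin n → Bool) → card t ≡ card (t ∘ Inverse.to π)
card-permute π t = ∑-permute (χ ∘ t) π

card-permute⁻ : ∀ {m n} (π : Fin m ↔ Fin n) (s : Fin m → Bool) → card (s ∘ Inverse.from π) ≡ card s
card-permute⁻ π s = trans (card-permute π (s ∘ Inverse.from π)) (card-cong (cong s ∘ Inverse.strictlyInverseʳ π))

∣∣≡card : ∀ {n} (S : Subset n) → ∣ S ∣ ≡ card (lookup S)
∣∣≡card [] = refl
∣∣≡card (true ∷ S) = cong suc (∣∣≡card S)
∣∣≡card (false ∷ S) = ∣∣≡card S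

∣tabulate∣ : ∀ {n} (t : Fin n → Bool) → ∣ tabulate t ∣ ≡ card t
∣tabulate∣ t = trans (∣∣≡card (tabulate t)) (card-cong (lookup∘tabulate t))

Adj : ℕ → Set
Adj n = Fin n → Fin n → Bool

SimpleAdj : ∀ {n} → Adj n → Set
SimpleAdj a = Simple (mkGraph _ a)

induced : ∀ {m n} → Adj n → (Fin m → Fin n) → Adj m
induced a f x y = a (f x) (f y)

induced-simple : ∀ {m n} {a : Adj n} (f : Fin m → Fin n) → SimpleAdj a → SimpleAdj (induced a f)
induced-simple f (sym-a , irrefl-a) = (λ i j → sym-a (f i) (f j)) , (irrefl-a ∘ f)

_<ᶠ_ : ∀ {n} → Fin n → Fin n → Bool
i <ᶠ j = toℕ i <ᵇ toℕ j

edges : ∀ {n} → Adj n → ℕ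
edges {n} a = ∑[ i < n ] ∑[ j < n ] χ ((i <ᶠ j) ∧ a i j)

degreeSum : ∀ {n} → Adj n → ℕ
degreeSum {n} a = ∑[ i < n ] ∑[ j < n ] χ (a i j)

edgeCount≡edges : ∀ G → edgeCount G ≡ edges (adj G)
edgeCount≡edges G =
  trans (list-sum-tabulate (λ i → count (λ j → (i <ᶠ j) ∧ adj G i j) (allFin (size G))) id)
        (sum-cong-≗ λ i → list-sum-tabulate (λ j → χ ((i <ᶠ j) ∧ adj G i j)) id)

edges-cong : ∀ {n} {a b : Adj n} → (∀ i j → a i j ≡ b i j) → edges a ≡ edges b
edges-cong a≗b = sum-cong-≗ λ i → sum-cong-≗ λ j → cong (λ x → χ ((i <ᶠ j) ∧ x)) (a≗b i j)

edges-mono : ∀ {n} {a b : Adj n} → (∀ i j → a i j ≡ true → b i j ≡ true) → edges a ≤ edges b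
edges-mono a⊆b = ∑-mono-≤ λ i → ∑-mono-≤ λ j → χ-mono (∧-mono (i <ᶠ j) (a⊆b i j))
  where
  ∧-mono : ∀ l {x y} → (x ≡ true → y ≡ true) → l ∧ x ≡ true → l ∧ y ≡ true
  ∧-mono true x⇒y = x⇒y

degreeSum≡2edges : ∀ {n} {a : Adj n} → SimpleAdj a → degreeSum a ≡ edges a + edges a
degreeSum≡2edges {n} {a} (sym-a , irrefl-a) = begin
  degreeSum a
    ≡⟨ sum-cong-≗ (λ i → trans (sum-cong-≗ (split i)) (∑-distrib-+ (λ j → upper i j) (λ j → upper j i))) ⟩
  ∑[ i < n ] (∑[ j < n ] upper i j + ∑[ j < n ] upper j i)
    ≡⟨ ∑-distrib-+ (λ i → ∑[ j < n ] upper i j) (λ i → ∑[ j < n ] upper j i) ⟩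
  edges a + ∑[ i < n ] ∑[ j < n ] upper j i
    ≡⟨ cong (edges a +_) (∑-comm (λ i j → upper j i)) ⟩
  edges a + edges a ∎
  where
  open ≡-Reasoning
  upper : Fin n → Fin n → ℕ
  upper i j = χ ((i <ᶠ j) ∧ a i j)
  split : ∀ i j → χ (a i j) ≡ upper i j + upper j i
  split i j with <-cmp (toℕ i) (toℕ j)
  ... | tri< i<j _ j≮i rewrite <ᵇ-true i<j | <ᵇ-false j≮i = sym (+-identityʳ _)
  ... | tri> i≮j _ j<i rewrite <ᵇ-true j<i | <ᵇ-false i≮j = cong χ (sym-a i j)
  ... | tri≈ _ i≡j _ with toℕ-injective i≡j
  ... | refl rewrite irrefl-a i | <ᵇ-false (n≮n (toℕ i)) = refl

degreeSum-permute : ∀ {m n} (a : Adj n) (π : Fin m ↔ Fin n) → degreeSum (induced a (Inverse.to π)) ≡ degreeSum a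
degreeSum-permute a π = sym (trans (∑-permute (λ i → ∑[ j < _ ] χ (a i j)) π)
  (sum-cong-≗ λ i → ∑-permute (λ j → χ (a (Inverse.to π i) j)) π))

edges-permute : ∀ {m n} {a : Adj n} (π : Fin m ↔ Fin n) → SimpleAdj a → edges (induced a (Inverse.to π)) ≡ edges a
edges-permute {m} {a = a} π simple-a = halve (begin
  edges a′ + edges a′ ≡⟨ degreeSum≡2edges (induced-simple (Inverse.to π) simple-a) ⟨
  degreeSum a′        ≡⟨ degreeSum-permute a π ⟩
  degreeSum a         ≡⟨ degreeSum≡2edges simple-a ⟩
  edges a + edges a   ∎)
  where
  open ≡-Reasoning
  a′ : Adj m
  a′ = induced a (Inverse.to π)
  halve : ∀ {x y} → x + x ≡ y + y → x ≡ y
  halve {x} {y} eq = trans (n≡⌊n+n/2⌋ x) (trans (cong ⌊_/2⌋ eq) (sym (n≡⌊n+n/2⌋ y)))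

edgeCount-mono : ∀ {n} {a b : Adj n} → (∀ i j → a i j ≡ true → b i j ≡ true) →
  edgeCount (mkGraph n a) ≤ edgeCount (mkGraph n b)
edgeCount-mono {a = a} {b} a⊆b =
  subst₂ _≤_ (sym (edgeCount≡edges (mkGraph _ a))) (sym (edgeCount≡edges (mkGraph _ b))) (edges-mono a⊆b)

simple-iso : ∀ {G H} → Iso G H → Simple G → Simple H
simple-iso {G} {H} (π , preserves) (sym-G , irrefl-G) =
  (λ x y → trans (adj-from x y) (trans (sym-G (from x) (from y)) (sym (adj-from y x)))) ,
  (λ x → trans (adj-from x x) (irrefl-G (from x)))
  where
  from : Fin (size H) → Fin (size G)
  from = Inverse.from π
  adj-from : ∀ x y → adj H x y ≡ adj G (from x) (from y)
  adj-from x y = sym (trans (preserves (from x) (from y))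
    (cong₂ (adj H) (Inverse.strictlyInverseˡ π x) (Inverse.strictlyInverseˡ π y)))

edgeCount-iso : ∀ {G H} → Iso G H → Simple H → edgeCount G ≡ edgeCount H
edgeCount-iso {G} {H} (π , preserves) simple-H = begin
  edgeCount G                             ≡⟨ edgeCount≡edges G ⟩
  edges (adj G)                           ≡⟨ edges-cong preserves ⟩
  edges (induced (adj H) (Inverse.to π))  ≡⟨ edges-permute π simple-H ⟩
  edges (adj H)                           ≡⟨ edgeCount≡edges H ⟨
  edgeCount H                             ∎
  where open ≡-Reasoning

-- Vertex covers

IsCover : ∀ {n} → Adj n → (Fin n → Bool) → Set
IsCover a t = ∀ i j → a i j ≡ true → t i ≡ true ⊎ t j ≡ true

IsMinCover : ∀ {n} → Adj n → (Fin n → Bool) → Set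
IsMinCover a s = IsCover a s × (∀ t → IsCover a t → card s ≤ card t)

isCover-weaken : ∀ {n} {a b : Adj n} {s t : Fin n → Bool} →
  (∀ i j → b i j ≡ true → a i j ≡ true) → (∀ i → s i ≡ true → t i ≡ true) → IsCover a s → IsCover b t
isCover-weaken b⊆a s⊆t cover i j bij with cover i j (b⊆a i j bij)
... | inj₁ si = inj₁ (s⊆t i si)
... | inj₂ sj = inj₂ (s⊆t j sj)

isCover-induced : ∀ {m n} {a : Adj n} {t : Fin n → Bool} (f : Fin m → Fin n) →
  IsCover a t → IsCover (induced a f) (t ∘ f)
isCover-induced f cover i j = cover (f i) (f j)

isMinCover-cong : ∀ {n} {a b : Adj n} {s t : Fin n → Bool} →
  (∀ i j → a i j ≡ b i j) → (∀ i → s i ≡ t i) → IsMinCover a s → IsMinCover b t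
isMinCover-cong a≗b s≗t (cover , minimal) =
  isCover-weaken (λ i j → trans (a≗b i j)) (λ i → trans (sym (s≗t i))) cover ,
  λ u u-cover → subst (_≤ card u) (card-cong s≗t)
    (minimal u (isCover-weaken (λ i j → trans (sym (a≗b i j))) (λ _ → id) u-cover))

isMinCover-permute : ∀ {m n} {b : Adj n} (π : Fin m ↔ Fin n) {s : Fin m → Bool} →
  IsMinCover (induced b (Inverse.to π)) s → IsMinCover b (s ∘ Inverse.from π)
isMinCover-permute {m} {n} {b} π {s} (cover , minimal) =
  (λ x y bxy → cover (from x) (from y) (subst₂ (λ x′ y′ → b x′ y′ ≡ true) (sym (to-from x)) (sym (to-from y)) bxy)) ,
  λ t t-cover → subst₂ _≤_ (sym (card-permute⁻ π s)) (sym (card-permute π t))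
    (minimal (t ∘ to) (λ x y → t-cover (to x) (to y)))
  where
  to : Fin m → Fin n
  to = Inverse.to π
  from : Fin n → Fin m
  from = Inverse.from π
  to-from : ∀ x → to (from x) ≡ x
  to-from = Inverse.strictlyInverseˡ π

isVC⇒isCover : ∀ G {S} → IsVC G S → IsCover (adj G) (lookup S)
isVC⇒isCover G vc i j Gij with vc i j Gij
... | inj₁ i∈S = inj₁ ([]=⇒lookup i∈S)
... | inj₂ j∈S = inj₂ ([]=⇒lookup j∈S)

isCover⇒isVC : ∀ G {S} → IsCover (adj G) (lookup S) → IsVC G S
isCover⇒isVC G {S} cover i j Gij with cover i j Gij
... | inj₁ Si = inj₁ (lookup⇒[]= i S Si)
... | inj₂ Sj = inj₂ (lookup⇒[]= j S Sj)

isCover⇒isVC-tabulate : ∀ G {t} → IsCover (adj G) t → IsVC G (tabulate t)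
isCover⇒isVC-tabulate G {t} cover =
  isCover⇒isVC G (isCover-weaken (λ _ _ → id) (λ i → trans (lookup∘tabulate t i)) cover)

isMinVC⇒isMinCover : ∀ G {S} → IsMinVC G S → IsMinCover (adj G) (lookup S)
isMinVC⇒isMinCover G {S} (vc , minimal) = isVC⇒isCover G vc , λ t t-cover →
  subst₂ _≤_ (∣∣≡card S) (∣tabulate∣ t) (minimal (tabulate t) (isCover⇒isVC-tabulate G t-cover))

isMinCover⇒isMinVC : ∀ G {s} → IsMinCover (adj G) s → IsMinVC G (tabulate s)
isMinCover⇒isMinVC G {s} (cover , minimal) = isCover⇒isVC-tabulate G cover , λ S S-vc →
  subst₂ _≤_ (sym (∣tabulate∣ s)) (sym (∣∣≡card S)) (minimal (lookup S) (isVC⇒isCover G S-vc))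

isMinCover⇒minVCSize : ∀ G {s} → IsMinCover (adj G) s → MinVCSize G (card s)
isMinCover⇒minVCSize G {s} min-s = tabulate s , isMinCover⇒isMinVC G min-s , ∣tabulate∣ s

minVCSize≤cover : ∀ G {k t} → MinVCSize G k → IsCover (adj G) t → k ≤ card t
minVCSize≤cover G {t = t} (S , (_ , minimal) , refl) t-cover =
  subst (∣ S ∣ ≤_) (∣tabulate∣ t) (minimal (tabulate t) (isCover⇒isVC-tabulate G t-cover))

minCover≤minVCSize : ∀ G {s k} → IsMinCover (adj G) s → MinVCSize G k → card s ≤ k
minCover≤minVCSize G (_ , minimal) (S , (vc , _) , refl) =
  subst (_ ≤_) (sym (∣∣≡card S)) (minimal (lookup S) (isVC⇒isCover G vc))

minVCSize-iso : ∀ {G H : Graph} → Iso G H → ∀ {s} → IsMinCover (adj G) s → MinVCSize H (card s)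
minVCSize-iso {G} {H} (π , preserves) {s} min-s = subst (MinVCSize H) (card-permute⁻ π s)
  (isMinCover⇒minVCSize H (isMinCover-permute π (isMinCover-cong preserves (λ _ → refl) min-s)))

deleteEdge : ∀ {n} → Adj n → Fin n → Fin n → Adj n
deleteEdge a i j = adj (removeEdge (mkGraph _ a) i j)

deleteEdge-⊆ : ∀ {n} (a : Adj n) i j x y → deleteEdge a i j x y ≡ true → a x y ≡ true
deleteEdge-⊆ a i j x y = Bool.∧-conicalˡ (a x y) _

deleteEdge-deletes : ∀ {n} (a : Adj n) i j → deleteEdge a i j i j ≡ false
deleteEdge-deletes a i j rewrite ⌊≟⌋-refl i | ⌊≟⌋-refl j = Bool.∧-zeroʳ (a i j)

deleteEdge-simple : ∀ {n} {a : Adj n} i j → SimpleAdj a → SimpleAdj (deleteEdge a i j)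
deleteEdge-simple {a = a} i j (sym-a , irrefl-a) =
  (λ x y → cong₂ _∧_ (sym-a x y) (cong not (trans
     (Bool.∨-comm (⌊ x ≟ i ⌋ ∧ ⌊ y ≟ j ⌋) (⌊ x ≟ j ⌋ ∧ ⌊ y ≟ i ⌋))
     (cong₂ _∨_ (Bool.∧-comm ⌊ x ≟ j ⌋ ⌊ y ≟ i ⌋) (Bool.∧-comm ⌊ x ≟ i ⌋ ⌊ y ≟ j ⌋))))) ,
  (λ x → cong (_∧ _) (irrefl-a x))

deleteEdge-induced : ∀ {m n} (a : Adj n) {f : Fin m → Fin n} → (∀ {x y} → f x ≡ f y → x ≡ y) →
  ∀ i j x y → deleteEdge a (f i) (f j) (f x) (f y) ≡ deleteEdge (induced a f) i j x y
deleteEdge-induced a {f} f-inj i j x y = cong (λ b → a (f x) (f y) ∧ not b)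
  (cong₂ _∨_ (cong₂ _∧_ (⌊≟⌋-injective f-inj x i) (⌊≟⌋-injective f-inj y j))
             (cong₂ _∧_ (⌊≟⌋-injective f-inj x j) (⌊≟⌋-injective f-inj y i)))

deleteEdge-away : ∀ {n} (a : Adj n) {i j x} y → x ≢ i → x ≢ j → deleteEdge a i j x y ≡ a x y
deleteEdge-away a y x≢i x≢j rewrite ⌊≟⌋-≢ x≢i | ⌊≟⌋-≢ x≢j = Bool.∧-identityʳ _

degreeSum-deleteEdge : ∀ {n} (a : Adj n) {i j} → a i j ≡ true → degreeSum (deleteEdge a i j) < degreeSum a
degreeSum-deleteEdge a {i} {j} aij = ∑-mono-< (λ x → ∑-mono-≤ (smaller x)) i
  (∑-mono-< (smaller i) j (subst₂ (λ x y → χ x < χ y) (sym (deleteEdge-deletes a i j)) (sym aij) ≤-refl))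
  where
  smaller : ∀ x y → χ (deleteEdge a i j x y) ≤ χ (a x y)
  smaller x y = χ-mono (deleteEdge-⊆ a i j x y)

Critical : ∀ {n} → Adj n → (Fin n → Bool) → Set
Critical a s = ∀ i j → a i j ≡ true → ∃[ t ] (IsCover (deleteEdge a i j) t × card t < card s)

critical⇒removeEdge-< : ∀ {n} {a : Adj n} {s} → IsMinCover a s → Critical a s →
  ∀ i j → a i j ≡ true → ∀ k k′ → MinVCSize (mkGraph n a) k → MinVCSize (removeEdge (mkGraph n a) i j) k′ → k′ < k
critical⇒removeEdge-< {a = a} min-s critical i j aij k k′ size-k size-k′ with critical i j aij
... | t , t-cover , t<s =
  ≤-<-trans (minVCSize≤cover (removeEdge (mkGraph _ a) i j) size-k′ t-cover)
            (<-≤-trans t<s (minCover≤minVCSize (mkGraph _ a) min-s size-k))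

module Split {N c r : ℕ} (ψ : (Fin c ⊎ Fin r) ↔ Fin N) where
  private
    to : Fin c ⊎ Fin r → Fin N
    to = Inverse.to ψ
    from : Fin N → Fin c ⊎ Fin r
    from = Inverse.from ψ

    to-injective : ∀ {z w} → to z ≡ to w → z ≡ w
    to-injective {z} {w} eq =
      trans (sym (Inverse.strictlyInverseʳ ψ z)) (trans (cong from eq) (Inverse.strictlyInverseʳ ψ w))

  e₁ : Fin c → Fin N
  e₁ = to ∘ inj₁

  e₂ : Fin r → Fin N
  e₂ = to ∘ inj₂

  e₁-injective : ∀ {u w} → e₁ u ≡ e₁ w → u ≡ w
  e₁-injective = inj₁-injective ∘ to-injective

  e₂-injective : ∀ {v w} → e₂ v ≡ e₂ w → v ≡ w
  e₂-injective = inj₂-injective ∘ to-injective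

  e₁≢e₂ : ∀ u v → e₁ u ≢ e₂ v
  e₁≢e₂ u v eq with to-injective eq
  ... | ()

  view : ∀ x → (∃[ u ] e₁ u ≡ x) ⊎ (∃[ v ] e₂ v ≡ x)
  view x with from x in eq
  ... | inj₁ u = inj₁ (u , trans (cong to (sym eq)) (Inverse.strictlyInverseˡ ψ x))
  ... | inj₂ v = inj₂ (v , trans (cong to (sym eq)) (Inverse.strictlyInverseˡ ψ x))

  card-split : ∀ t → card t ≡ card (t ∘ e₁) + card (t ∘ e₂)
  card-split t = begin
    card t
      ≡⟨ card-permute (↔-trans +↔⊎ ψ) t ⟩
    ∑[ z < c + r ] χ (t (to (splitAt c z)))
      ≡⟨ ∑-↑ c r (λ z → χ (t (to (splitAt c z)))) ⟩
    ∑[ u < c ] χ (t (to (splitAt c (u ↑ˡ r)))) + ∑[ v < r ] χ (t (to (splitAt c (c ↑ʳ v))))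
      ≡⟨ cong₂ _+_ (sum-cong-≗ λ u → cong (χ ∘ t ∘ to) (splitAt-↑ˡ c u r))
                   (sum-cong-≗ λ v → cong (χ ∘ t ∘ to) (splitAt-↑ʳ c r v)) ⟩
    card (t ∘ e₁) + card (t ∘ e₂) ∎
    where open ≡-Reasoning

  merge : (Fin c → Bool) → (Fin r → Bool) → Fin N → Bool
  merge t₁ t₂ = [ t₁ , t₂ ] ∘ from

  merge-e₁ : ∀ t₁ t₂ u → merge t₁ t₂ (e₁ u) ≡ t₁ u
  merge-e₁ t₁ t₂ u = cong [ t₁ , t₂ ] (Inverse.strictlyInverseʳ ψ (inj₁ u))

  merge-e₂ : ∀ t₁ t₂ v → merge t₁ t₂ (e₂ v) ≡ t₂ v
  merge-e₂ t₁ t₂ v = cong [ t₁ , t₂ ] (Inverse.strictlyInverseʳ ψ (inj₂ v))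

  card-merge : ∀ t₁ t₂ → card (merge t₁ t₂) ≡ card t₁ + card t₂
  card-merge t₁ t₂ = trans (card-split (merge t₁ t₂))
    (cong₂ _+_ (card-cong (merge-e₁ t₁ t₂)) (card-cong (merge-e₂ t₁ t₂)))

  view-e₁ : (Fin r → ⊥) → ∀ x → ∃[ u ] e₁ u ≡ x
  view-e₁ no-e₂ x with view x
  ... | inj₁ found = found
  ... | inj₂ (v , _) = ⊥-elim (no-e₂ v)

  ≗-split : ∀ {A : Set} {f g : Fin N → A} → (∀ u → f (e₁ u) ≡ g (e₁ u)) → (∀ v → f (e₂ v) ≡ g (e₂ v)) →
    ∀ x → f x ≡ g x
  ≗-split on₁ on₂ x with view x
  ... | inj₁ (u , refl) = on₁ u
  ... | inj₂ (v , refl) = on₂ v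

  Separated : Adj N → Set
  Separated a = (∀ u v → a (e₁ u) (e₂ v) ≡ false) × (∀ u v → a (e₂ v) (e₁ u) ≡ false)

  module _ {a : Adj N} (separated : Separated a) where
    private
      no-edge₁₂ : ∀ u v → a (e₁ u) (e₂ v) ≡ false
      no-edge₁₂ = proj₁ separated
      no-edge₂₁ : ∀ u v → a (e₂ v) (e₁ u) ≡ false
      no-edge₂₁ = proj₂ separated

    isCover-join : ∀ {t} → IsCover (induced a e₁) (t ∘ e₁) → IsCover (induced a e₂) (t ∘ e₂) → IsCover a t
    isCover-join cover₁ cover₂ x y axy with view x | view y
    ... | inj₁ (u , refl) | inj₁ (w , refl) = cover₁ u w axy
    ... | inj₂ (v , refl) | inj₂ (w , refl) = cover₂ v w axy
    ... | inj₁ (u , refl) | inj₂ (w , refl) = contradiction (trans (sym axy) (no-edge₁₂ u w)) λ ()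
    ... | inj₂ (v , refl) | inj₁ (w , refl) = contradiction (trans (sym axy) (no-edge₂₁ w v)) λ ()

    isCover-merge : ∀ {t₁ t₂} → IsCover (induced a e₁) t₁ → IsCover (induced a e₂) t₂ → IsCover a (merge t₁ t₂)
    isCover-merge {t₁} {t₂} cover₁ cover₂ = isCover-join
      (isCover-weaken (λ _ _ → id) (λ u → trans (merge-e₁ t₁ t₂ u)) cover₁)
      (isCover-weaken (λ _ _ → id) (λ v → trans (merge-e₂ t₁ t₂ v)) cover₂)

    isMinCover-join : ∀ {s} → IsMinCover (induced a e₁) (s ∘ e₁) → IsMinCover (induced a e₂) (s ∘ e₂) → IsMinCover a s
    isMinCover-join {s} (cover₁ , minimal₁) (cover₂ , minimal₂) = isCover-join cover₁ cover₂ , λ t t-cover →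
      subst₂ _≤_ (sym (card-split s)) (sym (card-split t))
        (+-mono-≤ (minimal₁ (t ∘ e₁) (isCover-induced e₁ t-cover)) (minimal₂ (t ∘ e₂) (isCover-induced e₂ t-cover)))

    isMinCover-restrict₁ : ∀ {s} → IsMinCover a s → IsMinCover (induced a e₁) (s ∘ e₁)
    isMinCover-restrict₁ {s} (cover , minimal) = isCover-induced e₁ cover , λ t₁ t₁-cover →
      +-cancelʳ-≤ _ _ _ (subst₂ _≤_ (card-split s) (card-merge t₁ (s ∘ e₂))
        (minimal (merge t₁ (s ∘ e₂)) (isCover-merge t₁-cover (isCover-induced e₂ cover))))

    isMinCover-restrict₂ : ∀ {s} → IsMinCover a s → IsMinCover (induced a e₂) (s ∘ e₂)
    isMinCover-restrict₂ {s} (cover , minimal) = isCover-induced e₂ cover , λ t₂ t₂-cover →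
      +-cancelˡ-≤ _ _ _ (subst₂ _≤_ (card-split s) (card-merge (s ∘ e₁) t₂)
        (minimal (merge (s ∘ e₁) t₂) (isCover-merge (isCover-induced e₁ cover) t₂-cover)))

    critical-restrict₁ : ∀ {s} → IsMinCover a s → Critical a s → Critical (induced a e₁) (s ∘ e₁)
    critical-restrict₁ {s} min-s critical i j aij with critical (e₁ i) (e₁ j) aij
    ... | t , t-cover , t<s = t ∘ e₁ , cover₁ , cancel (subst₂ _<_ (card-split t) (card-split s) t<s)
      where
      cover₁ : IsCover (deleteEdge (induced a e₁) i j) (t ∘ e₁)
      cover₁ = isCover-weaken (λ x y → trans (deleteEdge-induced a e₁-injective i j x y)) (λ _ → id)
        (isCover-induced e₁ t-cover)
      cover₂ : IsCover (induced a e₂) (t ∘ e₂)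
      cover₂ = isCover-weaken (λ v w → trans (deleteEdge-away a (e₂ w) (e₁≢e₂ i v ∘ sym) (e₁≢e₂ j v ∘ sym)))
        (λ _ → id) (isCover-induced e₂ t-cover)
      cancel : card (t ∘ e₁) + card (t ∘ e₂) < card (s ∘ e₁) + card (s ∘ e₂) → card (t ∘ e₁) < card (s ∘ e₁)
      cancel lt = +-cancelʳ-< _ _ _ (≤-<-trans (+-monoʳ-≤ _ (proj₂ (isMinCover-restrict₂ min-s) _ cover₂)) lt)

    critical-restrict₂ : ∀ {s} → IsMinCover a s → Critical a s → Critical (induced a e₂) (s ∘ e₂)
    critical-restrict₂ {s} min-s critical i j aij with critical (e₂ i) (e₂ j) aij
    ... | t , t-cover , t<s = t ∘ e₂ , cover₂ , cancel (subst₂ _<_ (card-split t) (card-split s) t<s)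
      where
      cover₂ : IsCover (deleteEdge (induced a e₂) i j) (t ∘ e₂)
      cover₂ = isCover-weaken (λ x y → trans (deleteEdge-induced a e₂-injective i j x y)) (λ _ → id)
        (isCover-induced e₂ t-cover)
      cover₁ : IsCover (induced a e₁) (t ∘ e₁)
      cover₁ = isCover-weaken (λ u w → trans (deleteEdge-away a (e₁ w) (e₁≢e₂ u i) (e₁≢e₂ u j)))
        (λ _ → id) (isCover-induced e₁ t-cover)
      cancel : card (t ∘ e₁) + card (t ∘ e₂) < card (s ∘ e₁) + card (s ∘ e₂) → card (t ∘ e₂) < card (s ∘ e₂)
      cancel lt = +-cancelˡ-< _ _ _ (≤-<-trans (+-monoˡ-≤ _ (proj₂ (isMinCover-restrict₁ min-s) _ cover₁)) lt)

    path-restrict₁ : ∀ {u y} → Path (mkGraph N a) (e₁ u) y → ∃[ w ] (e₁ w ≡ y × Path (mkGraph c (induced a e₁)) u w)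
    path-restrict₁ {u} here = u , refl , here
    path-restrict₁ {u} (step {j = z} e p) with view z
    ... | inj₁ (w , refl) with path-restrict₁ p
    ...   | w′ , e₁w′≡y , q = w′ , e₁w′≡y , step e q
    path-restrict₁ {u} (step e p) | inj₂ (v , refl) = contradiction (trans (sym e) (no-edge₁₂ u v)) λ ()

  adj-≗-split : ∀ {a b : Adj N} → Separated a → Separated b →
    (∀ u w → a (e₁ u) (e₁ w) ≡ b (e₁ u) (e₁ w)) → (∀ v w → a (e₂ v) (e₂ w) ≡ b (e₂ v) (e₂ w)) →
    ∀ x y → a x y ≡ b x y
  adj-≗-split (a₁₂ , a₂₁) (b₁₂ , b₂₁) on₁ on₂ x y with view x | view y
  ... | inj₁ (u , refl) | inj₁ (w , refl) = on₁ u w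
  ... | inj₂ (v , refl) | inj₂ (w , refl) = on₂ v w
  ... | inj₁ (u , refl) | inj₂ (w , refl) = trans (a₁₂ u w) (sym (b₁₂ u w))
  ... | inj₂ (v , refl) | inj₁ (w , refl) = trans (a₂₁ w v) (sym (b₂₁ w v))

-- Disjoint unions and the inclusion of the range

adj-⊎ : ∀ {n₁ n₂} → Adj n₁ → Adj n₂ → Fin n₁ ⊎ Fin n₂ → Fin n₁ ⊎ Fin n₂ → Bool
adj-⊎ a₁ a₂ (inj₁ u) (inj₁ w) = a₁ u w
adj-⊎ a₁ a₂ (inj₂ v) (inj₂ w) = a₂ v w
adj-⊎ a₁ a₂ (inj₁ _) (inj₂ _) = false
adj-⊎ a₁ a₂ (inj₂ _) (inj₁ _) = false

adj-⊕ : ∀ T₁ T₂ (x y : Fin (size (graph T₁) + size (graph T₂))) →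
  adj (graph (T₁ ⊕ T₂)) x y ≡
  adj-⊎ (adj (graph T₁)) (adj (graph T₂)) (splitAt (size (graph T₁)) x) (splitAt (size (graph T₁)) y)
adj-⊕ T₁ T₂ x y with splitAt (size (graph T₁)) x | splitAt (size (graph T₁)) y
... | inj₁ _ | inj₁ _ = refl
... | inj₂ _ | inj₂ _ = refl
... | inj₁ _ | inj₂ _ = refl
... | inj₂ _ | inj₁ _ = refl

side-⊕ : ∀ T₁ T₂ (x : Fin (size (graph T₁) + size (graph T₂))) →
  side (T₁ ⊕ T₂) x ≡ [ side T₁ , side T₂ ] (splitAt (size (graph T₁)) x)
side-⊕ T₁ T₂ x with splitAt (size (graph T₁)) x
... | inj₁ _ = refl
... | inj₂ _ = refl

module DisjointUnion (T₁ T₂ : Triple) where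
  private
    n₁ n₂ : ℕ
    n₁ = size (graph T₁)
    n₂ = size (graph T₂)
    a : Adj (n₁ + n₂)
    a = adj (graph (T₁ ⊕ T₂))

  open Split {n₁ + n₂} {n₁} {n₂} (↔-sym +↔⊎) public

  adj-e₁ : ∀ u w → a (e₁ u) (e₁ w) ≡ adj (graph T₁) u w
  adj-e₁ u w rewrite adj-⊕ T₁ T₂ (u ↑ˡ n₂) (w ↑ˡ n₂) | splitAt-↑ˡ n₁ u n₂ | splitAt-↑ˡ n₁ w n₂ = refl

  adj-e₂ : ∀ v w → a (e₂ v) (e₂ w) ≡ adj (graph T₂) v w
  adj-e₂ v w rewrite adj-⊕ T₁ T₂ (n₁ ↑ʳ v) (n₁ ↑ʳ w) | splitAt-↑ʳ n₁ n₂ v | splitAt-↑ʳ n₁ n₂ w = refl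

  separated : Separated a
  separated =
    (λ u v → trans (adj-⊕ T₁ T₂ (u ↑ˡ n₂) (n₁ ↑ʳ v)) (cong₂ adj-⊎′ (splitAt-↑ˡ n₁ u n₂) (splitAt-↑ʳ n₁ n₂ v))) ,
    (λ u v → trans (adj-⊕ T₁ T₂ (n₁ ↑ʳ v) (u ↑ˡ n₂)) (cong₂ adj-⊎′ (splitAt-↑ʳ n₁ n₂ v) (splitAt-↑ˡ n₁ u n₂)))
    where
    adj-⊎′ : Fin n₁ ⊎ Fin n₂ → Fin n₁ ⊎ Fin n₂ → Bool
    adj-⊎′ = adj-⊎ (adj (graph T₁)) (adj (graph T₂))

  side-e₁ : ∀ u → side (T₁ ⊕ T₂) (e₁ u) ≡ side T₁ u
  side-e₁ u rewrite side-⊕ T₁ T₂ (u ↑ˡ n₂) | splitAt-↑ˡ n₁ u n₂ = refl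

  side-e₂ : ∀ v → side (T₁ ⊕ T₂) (e₂ v) ≡ side T₂ v
  side-e₂ v rewrite side-⊕ T₁ T₂ (n₁ ↑ʳ v) | splitAt-↑ʳ n₁ n₂ v = refl

  isMinCover-⊕ : IsMinCover (adj (graph T₁)) (side T₁) → IsMinCover (adj (graph T₂)) (side T₂) →
    IsMinCover a (side (T₁ ⊕ T₂))
  isMinCover-⊕ min₁ min₂ = isMinCover-join separated
    (isMinCover-cong (λ u w → sym (adj-e₁ u w)) (sym ∘ side-e₁) min₁)
    (isMinCover-cong (λ v w → sym (adj-e₂ v w)) (sym ∘ side-e₂) min₂)

  card-side-⊕ : card (side (T₁ ⊕ T₂)) ≡ card (side T₁) + card (side T₂)
  card-side-⊕ = trans (card-split (side (T₁ ⊕ T₂))) (cong₂ _+_ (card-cong side-e₁) (card-cong side-e₂))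

isMinCover-addCovered : ∀ {n} {a b : Adj n} {s} → (∀ i j → a i j ≡ true → b i j ≡ true) →
  (∀ i j → b i j ≡ true → a i j ≡ false → s i ≡ true ⊎ s j ≡ true) → IsMinCover a s → IsMinCover b s
isMinCover-addCovered {a = a} {b} {s} a⊆b new-covered (cover , minimal) =
  (λ i j bij → covered i j bij (a i j) refl) , λ t t-cover → minimal t (isCover-weaken a⊆b (λ _ → id) t-cover)
  where
  covered : ∀ i j → b i j ≡ true → ∀ x → a i j ≡ x → s i ≡ true ⊎ s j ≡ true
  covered i j bij true aij = cover i j aij
  covered i j bij false aij = new-covered i j bij aij

inB⇒isMinCover : ∀ {T} → InB T → IsMinCover (adj (graph T)) (side T)
inB⇒isMinCover {T} (_ , _ , min-U) =
  isMinCover-cong (λ _ _ → refl) (lookup∘tabulate (side T)) (isMinVC⇒isMinCover (graph T) min-U)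

C-isMinCover : ∀ {Ss} → All InB Ss → IsMinCover (adj (graph (C Ss))) (side (C Ss))
C-isMinCover [] = (λ ()) , λ _ _ → z≤n
C-isMinCover {T ∷ Ss} (T∈B ∷ Ss∈B) = DisjointUnion.isMinCover-⊕ T (C Ss) (inB⇒isMinCover T∈B) (C-isMinCover Ss∈B)

G2-isMinCover : ∀ n {T} → IsMinCover (adj (graph T)) (side T) → IsMinCover (adj (graph (G2 n T))) (side (G2 n T))
G2-isMinCover n {T} min-T = DisjointUnion.isMinCover-⊕ T (isolatedV _) min-T
  ((λ _ _ ()) , λ t _ → subst (_≤ card t) (sym (card-empty (n ∸ size (graph T)))) z≤n)

card-side-G2 : ∀ n T → card (side (G2 n T)) ≡ card (side T)
card-side-G2 n T = trans (DisjointUnion.card-side-⊕ T (isolatedV _))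
  (trans (cong (card (side T) +_) (card-empty (n ∸ size (graph T)))) (+-identityʳ _))

∣Vset∣+∣Uset∣≡size : ∀ T → ∣ Vset T ∣ + ∣ Uset T ∣ ≡ size (graph T)
∣Vset∣+∣Uset∣≡size T = trans (cong₂ _+_ (∣tabulate∣ (not ∘ side T)) (∣tabulate∣ (side T)))
  (trans (+-comm (card (not ∘ side T)) _) (card-complement (side T)))

size-G2 : ∀ {n} T → ∣ Vset T ∣ + ∣ Uset T ∣ ≤ n → size (graph (G2 n T)) ≡ n
size-G2 T ∣V∣+∣U∣≤n = m+[n∸m]≡n (subst (_≤ _) (∣Vset∣+∣Uset∣≡size T) ∣V∣+∣U∣≤n)

inRange⇒properties : ∀ ℓ m n G → InRange ℓ m n G → Simple G × size G ≡ n × edgeCount G ≡ m × MinVCSize G ℓ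
inRange⇒properties ℓ m n G (Ss , (Ss∈B , ∣U∣≡ℓ , ∣V∣+ℓ≤n , _) , (a , simple-a , old⊆a , new-covered , edges-a) , iso) =
  simple-G ,
  trans (sym (↔⇒≡ (proj₁ iso))) (size-G2 T (subst (λ k → ∣ Vset T ∣ + k ≤ n) (sym ∣U∣≡ℓ) ∣V∣+ℓ≤n)) ,
  trans (sym (edgeCount-iso iso simple-G)) edges-a ,
  subst (MinVCSize G) card-U (minVCSize-iso iso (isMinCover-addCovered old⊆a new-covered (G2-isMinCover n (C-isMinCover Ss∈B))))
  where
  T : Triple
  T = C Ss
  simple-G : Simple G
  simple-G = simple-iso iso simple-a
  card-U : card (side (G2 n T)) ≡ ℓ
  card-U = trans (card-side-G2 n T) (trans (sym (∣tabulate∣ (side T))) ∣U∣≡ℓ)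

module Paths {n : ℕ} (a : Adj n) where
  private
    H : Graph
    H = mkGraph n a

  _▷_ : ∀ {i j k} → Path H i j → a j k ≡ true → Path H i k
  here ▷ e = step e here
  step e p ▷ e′ = step e (p ▷ e′)

  _++ₚ_ : ∀ {i j k} → Path H i j → Path H j k → Path H i k
  here ++ₚ q = q
  step e p ++ₚ q = step e (p ++ₚ q)

  reverse : (∀ i j → a i j ≡ a j i) → ∀ {i j} → Path H i j → Path H j i
  reverse sym-a here = here
  reverse sym-a (step e p) = reverse sym-a p ▷ trans (sym-a _ _) e

module Component {n : ℕ} (a : Adj n) (v₀ : Fin n) where
  open Paths a
  private
    H : Graph
    H = mkGraph n a

  ClosedAt : (Fin n → Bool) → Fin n → Fin n → Set
  ClosedAt k z x = k z ≡ true → a z x ≡ true → k x ≡ true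

  Closed : (Fin n → Bool) → Set
  Closed k = ∀ z x → ClosedAt k z x

  closedAt? : ∀ k z x → Dec (ClosedAt k z x)
  closedAt? k z x = (k z Bool.≟ true) →-dec ((a z x Bool.≟ true) →-dec (k x Bool.≟ true))

  closed? : ∀ k → Dec (Closed k)
  closed? k = all? λ z → all? (closedAt? k z)

  leaving-edge : ∀ k → ¬ Closed k → ∃₂ λ z x → k z ≡ true × a z x ≡ true × k x ≡ false
  leaving-edge k open-k with ¬∀⟶∃¬ n (λ z → ∀ x → ClosedAt k z x) (λ z → all? (closedAt? k z)) open-k
  ... | z , ¬∀x with ¬∀⟶∃¬ n (ClosedAt k z) (closedAt? k z) ¬∀x
  ... | x , ¬[kz→azx→kx] with ¬→⇒×¬ (k z Bool.≟ true) ¬[kz→azx→kx]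
  ... | kz , ¬[azx→kx] with ¬→⇒×¬ (a z x Bool.≟ true) ¬[azx→kx]
  ... | azx , kx≢true = z , x , kz , azx , Bool.¬-not kx≢true

  reach : ℕ → Fin n → Bool
  reach zero x = ⌊ x ≟ v₀ ⌋
  reach (suc t) x = reach t x ∨ ⌊ any? (λ z → reach t z ∧ a z x Bool.≟ true) ⌋

  reach-v₀ : ∀ t → reach t v₀ ≡ true
  reach-v₀ zero = ⌊≟⌋-refl v₀
  reach-v₀ (suc t) rewrite reach-v₀ t = refl

  reach-suc : ∀ t x → reach t x ≡ true → reach (suc t) x ≡ true
  reach-suc t x reach-x rewrite reach-x = refl

  reach-edge : ∀ t z x → reach t z ≡ true → a z x ≡ true → reach (suc t) x ≡ true
  reach-edge t z x reach-z azx with reach t x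
  ... | true = refl
  ... | false = ⌊⌋-intro (any? _) (z , cong₂ _∧_ reach-z azx)

  reach-path : ∀ t x → reach t x ≡ true → Path H v₀ x
  reach-path zero x reach-x with ⌊⌋-true⇒ (x ≟ v₀) reach-x
  ... | refl = here
  reach-path (suc t) x reach-x with reach t x in eq
  ... | true = reach-path t x eq
  ... | false with ⌊⌋-true⇒ (any? λ z → reach t z ∧ a z x Bool.≟ true) reach-x
  ... | z , zx = reach-path t z (Bool.∧-conicalˡ _ _ zx) ▷ Bool.∧-conicalʳ _ _ zx

  reach-stable : ∀ t → Closed (reach t) → ∀ x → reach (suc t) x ≡ true → reach t x ≡ true
  reach-stable t closed x reach-x with reach t x in eq
  ... | true = refl
  ... | false with ⌊⌋-true⇒ (any? λ z → reach t z ∧ a z x Bool.≟ true) reach-x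
  ... | z , zx = trans (sym eq) (closed z x (Bool.∧-conicalˡ _ _ zx) (Bool.∧-conicalʳ _ _ zx))

  closed-suc : ∀ t → Closed (reach t) → Closed (reach (suc t))
  closed-suc t closed z x reach-z azx = reach-suc t x (closed z x (reach-stable t closed z reach-z) azx)

  reach-grows : ∀ t → Closed (reach t) ⊎ suc t ≤ card (reach t)
  reach-grows zero = inj₂ (subst (_≤ card (reach zero)) (cong χ (reach-v₀ zero)) (∑-term (χ ∘ reach zero) v₀))
  reach-grows (suc t) with reach-grows t | closed? (reach t)
  ... | inj₁ closed | _ = inj₁ (closed-suc t closed)
  ... | inj₂ _ | yes closed = inj₁ (closed-suc t closed)
  ... | inj₂ t<card | no open-t with leaving-edge (reach t) open-t
  ... | z , x , reach-z , azx , ¬reach-x =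
    inj₂ (<-≤-trans (s≤s t<card) (card-mono-< (reach-suc t) x ¬reach-x (reach-edge t z x reach-z azx)))

  component : Fin n → Bool
  component = reach n

  component-closed : Closed component
  component-closed with reach-grows n
  ... | inj₁ closed = closed
  ... | inj₂ n<card = contradiction (card≤n component) (<⇒≱ n<card)

  component-v₀ : component v₀ ≡ true
  component-v₀ = reach-v₀ n

  component-path : ∀ x → component x ≡ true → Path H v₀ x
  component-path = reach-path n

insert₁ : ∀ {c r N} → (Fin c ⊎ Fin r) ↔ Fin N → (Fin (suc c) ⊎ Fin r) ↔ Fin (suc N)
insert₁ {c} {r} {N} ψ = mk↔ₛ′ to′ from′ to∘from from∘to
  where
  to′ : Fin (suc c) ⊎ Fin r → Fin (suc N)
  to′ (inj₁ zero) = zero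
  to′ (inj₁ (suc u)) = suc (Inverse.to ψ (inj₁ u))
  to′ (inj₂ v) = suc (Inverse.to ψ (inj₂ v))
  from′ : Fin (suc N) → Fin (suc c) ⊎ Fin r
  from′ zero = inj₁ zero
  from′ (suc x) = map₁ suc (Inverse.from ψ x)
  to′-shift : ∀ y → to′ (map₁ suc y) ≡ suc (Inverse.to ψ y)
  to′-shift (inj₁ u) = refl
  to′-shift (inj₂ v) = refl
  to∘from : ∀ x → to′ (from′ x) ≡ x
  to∘from zero = refl
  to∘from (suc x) = trans (to′-shift (Inverse.from ψ x)) (cong suc (Inverse.strictlyInverseˡ ψ x))
  from∘to : ∀ y → from′ (to′ y) ≡ y
  from∘to (inj₁ zero) = refl
  from∘to (inj₁ (suc u)) = cong (map₁ suc) (Inverse.strictlyInverseʳ ψ (inj₁ u))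
  from∘to (inj₂ v) = cong (map₁ suc) (Inverse.strictlyInverseʳ ψ (inj₂ v))

insert₂ : ∀ {c r N} → (Fin c ⊎ Fin r) ↔ Fin N → (Fin c ⊎ Fin (suc r)) ↔ Fin (suc N)
insert₂ ψ = ↔-trans (⊎-comm _ _) (insert₁ (↔-trans (⊎-comm _ _) ψ))

record Partition {N : ℕ} (k : Fin N → Bool) : Set where
  field
    c r : ℕ
    ψ : (Fin c ⊎ Fin r) ↔ Fin N
    inside : ∀ u → k (Inverse.to ψ (inj₁ u)) ≡ true
    outside : ∀ v → k (Inverse.to ψ (inj₂ v)) ≡ false

partition : ∀ {N} (k : Fin N → Bool) → Partition k
partition {zero} k = record
  { c = 0 ; r = 0
  ; ψ = mk↔ₛ′ [ (λ ()) , (λ ()) ] (λ ()) (λ ()) [ (λ ()) , (λ ()) ]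
  ; inside = λ () ; outside = λ () }
partition {suc N} k with partition (k ∘ suc) | k zero in k₀
... | P | true = record
  { c = suc c ; r = r ; ψ = insert₁ ψ
  ; inside = λ { zero → k₀ ; (suc u) → inside u } ; outside = outside }
  where open Partition P
... | P | false = record
  { c = c ; r = suc r ; ψ = insert₂ ψ
  ; inside = inside ; outside = λ { zero → k₀ ; (suc v) → outside v } }
  where open Partition P

-- Decomposition of a critical graph into components

Fin⇒0< : ∀ {n} → Fin n → 0 < n
Fin⇒0< {suc n} _ = z<s

connected-from-root : ∀ {c} {b : Adj c} → (∀ i j → b i j ≡ b j i) → ∀ u₀ →
  (∀ j → Path (mkGraph c b) u₀ j) → Connected (mkGraph c b)
connected-from-root {suc c} {b} sym-b u₀ paths = s≤s z≤n , λ i j → reverse sym-b (paths i) ++ₚ paths j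
  where open Paths b

record Decomposition {N : ℕ} (a : Adj N) (s : Fin N → Bool) : Set where
  field
    parts : List Triple
    parts∈B : All InB parts
    iso : Iso (graph (C parts)) (mkGraph N a)
    side-iso : ∀ x → side (C parts) x ≡ s (Inverse.to (proj₁ iso) x)

module ComponentSplit {N : ℕ} {a : Adj (suc N)} (simple-a : SimpleAdj a) where
  open Component a zero
  open Partition (partition component) public
  open Split ψ public

  separated : Separated a
  separated = no-edge₁₂ , λ u v → trans (proj₁ simple-a (e₂ v) (e₁ u)) (no-edge₁₂ u v)
    where
    no-edge₁₂ : ∀ u v → a (e₁ u) (e₂ v) ≡ false
    no-edge₁₂ u v = Bool.¬-not λ e → contradiction (trans (sym (component-closed _ _ (inside u) e)) (outside v)) λ ()

  root : ∃[ u₀ ] e₁ u₀ ≡ zero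
  root with view zero
  ... | inj₁ found = found
  ... | inj₂ (v , e₂v≡0) = contradiction (trans (sym component-v₀) (trans (cong component (sym e₂v≡0)) (outside v))) λ ()

  connected : Connected (mkGraph c (induced a e₁))
  connected = connected-from-root (proj₁ (induced-simple e₁ simple-a)) (proj₁ root) path
    where
    path : ∀ j → Path (mkGraph c (induced a e₁)) (proj₁ root) j
    path j with path-restrict₁ separated
                  (subst (λ x → Path (mkGraph _ a) x (e₁ j)) (sym (proj₂ root)) (component-path (e₁ j) (inside j)))
    ... | w , e₁w≡e₁j , p = subst (Path _ _) (e₁-injective e₁w≡e₁j) p

  rest<suc : r < suc N
  rest<suc = subst (r <_) (↔⇒≡ (↔-trans +↔⊎ ψ)) (m<n+m r (Fin⇒0< (proj₁ root)))

  componentTriple : (Fin (suc N) → Bool) → Triple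
  componentTriple s = mkTriple (mkGraph c (induced a e₁)) (s ∘ e₁)

  component∈B : ∀ {s} → IsMinCover a s → Critical a s → InB (componentTriple s)
  component∈B {s} min-s critical =
    induced-simple e₁ simple-a ,
    (connected , critical⇒removeEdge-< min₁ (critical-restrict₁ separated min-s critical)) ,
    isMinCover⇒isMinVC (mkGraph c (induced a e₁)) min₁
    where
    min₁ : IsMinCover (induced a e₁) (s ∘ e₁)
    min₁ = isMinCover-restrict₁ separated min-s

  extend : ∀ {s} → IsMinCover a s → Critical a s → Decomposition (induced a e₂) (s ∘ e₂) → Decomposition a s
  extend {s} min-s critical rest = record
    { parts = componentTriple s ∷ parts
    ; parts∈B = component∈B min-s critical ∷ parts∈B
    ; iso = Φ , U.adj-≗-split U.separated separated-Φ
        (λ u w → trans (U.adj-e₁ u w) (sym (cong₂ a (Φ-e₁ u) (Φ-e₁ w))))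
        (λ v w → trans (U.adj-e₂ v w) (trans (proj₂ iso v w) (sym (cong₂ a (Φ-e₂ v) (Φ-e₂ w)))))
    ; side-iso = U.≗-split
        (λ u → trans (U.side-e₁ u) (sym (cong s (Φ-e₁ u))))
        (λ v → trans (U.side-e₂ v) (trans (side-iso v) (sym (cong s (Φ-e₂ v)))))
    }
    where
    open Decomposition rest
    module U = DisjointUnion (componentTriple s) (C parts)
    m : ℕ
    m = size (graph (C parts))
    Φ : Fin (c + m) ↔ Fin (suc N)
    Φ = ↔-trans +↔⊎ (↔-trans (⊎-cong ↔-refl (proj₁ iso)) ψ)
    Φ-e₁ : ∀ u → Inverse.to Φ (U.e₁ u) ≡ e₁ u
    Φ-e₁ u = cong (Inverse.to ψ ∘ Data.Sum.map id (Inverse.to (proj₁ iso))) (splitAt-↑ˡ c u m)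
    Φ-e₂ : ∀ v → Inverse.to Φ (U.e₂ v) ≡ e₂ (Inverse.to (proj₁ iso) v)
    Φ-e₂ v = cong (Inverse.to ψ ∘ Data.Sum.map id (Inverse.to (proj₁ iso))) (splitAt-↑ʳ c m v)
    separated-Φ : U.Separated (induced a (Inverse.to Φ))
    separated-Φ =
      (λ u v → trans (cong₂ a (Φ-e₁ u) (Φ-e₂ v)) (proj₁ separated u _)) ,
      (λ u v → trans (cong₂ a (Φ-e₂ v) (Φ-e₁ u)) (proj₂ separated u _))

Decomposable : ℕ → Set
Decomposable N = ∀ {a : Adj N} {s} → SimpleAdj a → IsMinCover a s → Critical a s → Decomposition a s

decompose : ∀ N → Decomposable N
decompose = <-rec Decomposable split-off-component
  where
  split-off-component : ∀ N → (∀ {M} → M < N → Decomposable M) → Decomposable N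
  split-off-component zero _ _ _ _ = record { parts = [] ; parts∈B = [] ; iso = ↔-refl , (λ ()) ; side-iso = λ () }
  split-off-component (suc N) decompose-smaller simple-a min-s critical =
    extend min-s critical (decompose-smaller rest<suc (induced-simple e₂ simple-a)
      (isMinCover-restrict₂ separated min-s) (critical-restrict₂ separated min-s critical))
    where open ComponentSplit simple-a

-- Critical subgraphs

isCover? : ∀ {n} (a : Adj n) t → Dec (IsCover a t)
isCover? a t = all? λ i → all? λ j → (a i j Bool.≟ true) →-dec ((t i Bool.≟ true) ⊎-dec (t j Bool.≟ true))

HasSmallerCover : ∀ {n} → Adj n → (Fin n → Bool) → Set
HasSmallerCover a s = ∃[ S ] (IsCover a (lookup S) × card (lookup S) < card s)

hasSmallerCover? : ∀ {n} (a : Adj n) s → Dec (HasSmallerCover a s)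
hasSmallerCover? a s = anySubset? λ S → isCover? a (lookup S) ×-dec (card (lookup S) <? card s)

criticalAt? : ∀ {n} (a : Adj n) s i j → Dec (a i j ≡ true → HasSmallerCover (deleteEdge a i j) s)
criticalAt? a s i j = (a i j Bool.≟ true) →-dec hasSmallerCover? (deleteEdge a i j) s

critical-or-removable : ∀ {n} (a : Adj n) s →
  Critical a s ⊎ ∃₂ λ i j → a i j ≡ true × (∀ t → IsCover (deleteEdge a i j) t → card s ≤ card t)
critical-or-removable {n} a s with all? (λ i → all? (criticalAt? a s i))
... | yes critical = inj₁ λ i j aij → let S , cover , S<s = critical i j aij in lookup S , cover , S<s
... | no ¬critical with ¬∀⟶∃¬ n _ (λ i → all? (criticalAt? a s i)) ¬critical
... | i , ¬critical-i with ¬∀⟶∃¬ n _ (criticalAt? a s i) ¬critical-i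
... | j , ¬critical-ij with ¬→⇒×¬ (a i j Bool.≟ true) ¬critical-ij
... | aij , no-smaller = inj₂ (i , j , aij , λ t cover → ≮⇒≥ λ t<s →
      no-smaller (tabulate t ,
        isCover-weaken (λ _ _ → id) (λ x → trans (lookup∘tabulate t x)) cover ,
        subst (_< card s) (sym (card-cong (lookup∘tabulate t))) t<s))

record CriticalSubgraph {n : ℕ} (a : Adj n) (s : Fin n → Bool) : Set where
  field
    sub : Adj n
    simple : SimpleAdj sub
    sub⊆a : ∀ i j → sub i j ≡ true → a i j ≡ true
    minCover : IsMinCover sub s
    critical : Critical sub s

criticalSubgraph : ∀ {n} {a : Adj n} {s} → SimpleAdj a → IsMinCover a s → CriticalSubgraph a s
criticalSubgraph {n} {a} {s} = shrink (degreeSum a) a refl (λ _ _ → id)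
  where
  Shrinkable : ℕ → Set
  Shrinkable k = ∀ b → degreeSum b ≡ k → (∀ i j → b i j ≡ true → a i j ≡ true) →
    SimpleAdj b → IsMinCover b s → CriticalSubgraph a s

  shrink : ∀ k → Shrinkable k
  shrink = <-rec Shrinkable λ k shrink-smaller b size-b b⊆a simple-b min-s →
    case critical-or-removable b s of λ where
      (inj₁ critical) → record { sub = b ; simple = simple-b ; sub⊆a = b⊆a ; minCover = min-s ; critical = critical }
      (inj₂ (i , j , bij , still-minimal)) →
        shrink-smaller (subst (_ <_) size-b (degreeSum-deleteEdge b bij)) (deleteEdge b i j) refl
          (λ x y → b⊆a x y ∘ deleteEdge-⊆ b i j x y) (deleteEdge-simple i j simple-b)
          (isCover-weaken (deleteEdge-⊆ b i j) (λ _ → id) (proj₁ min-s) , still-minimal)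

-- The converse inclusion

↔-pad : ∀ {m n} k → k ≡ 0 → Fin m ↔ Fin n → Fin (m + k) ↔ Fin n
↔-pad .0 refl π = ↔-trans +↔⊎ (↔-trans (mk↔ₛ′ [ id , (λ ()) ] inj₁ (λ _ → refl) [ (λ _ → refl) , (λ ()) ]) π)

↔-pad-↑ˡ : ∀ {m n} k (k≡0 : k ≡ 0) (π : Fin m ↔ Fin n) x → Inverse.to (↔-pad k k≡0 π) (x ↑ˡ k) ≡ Inverse.to π x
↔-pad-↑ˡ {m} .0 refl π x = cong (Inverse.to π ∘ [ id , (λ ()) ]) (splitAt-↑ˡ m x 0)

module Reassembly {G : Graph} {n : ℕ} (size-G : size G ≡ n) {s : Fin (size G) → Bool}
  (min-s : IsMinCover (adj G) s) (H : CriticalSubgraph (adj G) s) (D : Decomposition (CriticalSubgraph.sub H) s) where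
  open CriticalSubgraph H
  open Decomposition D public

  T : Triple
  T = C parts

  π : Fin (size (graph T)) ↔ Fin (size G)
  π = proj₁ iso

  size-T : size (graph T) ≡ n
  size-T = trans (↔⇒≡ π) size-G

  card-side : card (side T) ≡ card s
  card-side = trans (card-cong side-iso) (sym (card-permute π s))

  admissible : ∀ {ℓ m} → card s ≡ ℓ → edgeCount G ≡ m → G1Admissible ℓ m n parts
  admissible {ℓ} {m} card-s edges-G = parts∈B , ∣U∣≡ℓ ,
    ≤-reflexive (trans (cong (∣ Vset T ∣ +_) (sym ∣U∣≡ℓ)) (trans (∣Vset∣+∣Uset∣≡size T) size-T)) ,
    subst (_≤ m) (sym (edgeCount-iso iso simple)) (subst (edgeCount (mkGraph _ sub) ≤_) edges-G (edgeCount-mono sub⊆a))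
    where
    ∣U∣≡ℓ : ∣ Uset T ∣ ≡ ℓ
    ∣U∣≡ℓ = trans (∣tabulate∣ (side T)) (trans card-side card-s)

  -- 𝓖² adds no vertices: the parts already account for all n vertices of G.
  k : ℕ
  k = n ∸ size (graph T)

  k≡0 : k ≡ 0
  k≡0 = trans (cong (n ∸_) size-T) (n∸n≡0 n)

  Φ : Fin (size (graph T) + k) ↔ Fin (size G)
  Φ = ↔-pad k k≡0 π

  module U = DisjointUnion T (isolatedV k)

  padded : ∀ x → ∃[ u ] U.e₁ u ≡ x
  padded = U.view-e₁ λ v → ⊥-elim (case subst Fin k≡0 v of λ ())

  to-e₁ : ∀ u → Inverse.to Φ (U.e₁ u) ≡ Inverse.to π u
  to-e₁ = ↔-pad-↑ˡ k k≡0 π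

  a′ : Adj (size (graph T) + k)
  a′ = induced (adj G) (Inverse.to Φ)

  side-G2 : ∀ x → side (G2 n T) x ≡ s (Inverse.to Φ x)
  side-G2 x = trans (cong (side (G2 n T)) (sym (proj₂ (padded x))))
    (trans (on-part (proj₁ (padded x))) (cong (s ∘ Inverse.to Φ) (proj₂ (padded x))))
    where
    on-part : ∀ u → side (G2 n T) (U.e₁ u) ≡ s (Inverse.to Φ (U.e₁ u))
    on-part u = trans (U.side-e₁ u) (trans (side-iso u) (cong s (sym (to-e₁ u))))

  old⊆a′ : ∀ x y → adj (graph (G2 n T)) x y ≡ true → a′ x y ≡ true
  old⊆a′ x y = subst₂ (λ x y → adj (graph (G2 n T)) x y ≡ true → a′ x y ≡ true)
    (proj₂ (padded x)) (proj₂ (padded y)) (on-part (proj₁ (padded x)) (proj₁ (padded y)))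
    where
    on-part : ∀ u w → adj (graph (G2 n T)) (U.e₁ u) (U.e₁ w) ≡ true → a′ (U.e₁ u) (U.e₁ w) ≡ true
    on-part u w uw = subst₂ (λ x′ y′ → adj G x′ y′ ≡ true) (sym (to-e₁ u)) (sym (to-e₁ w))
      (sub⊆a _ _ (trans (sym (proj₂ iso u w)) (trans (sym (U.adj-e₁ u w)) uw)))

  a′-covered : ∀ x y → a′ x y ≡ true → side (G2 n T) x ≡ true ⊎ side (G2 n T) y ≡ true
  a′-covered x y xy =
    Data.Sum.map (trans (side-G2 x)) (trans (side-G2 y)) (proj₁ min-s (Inverse.to Φ x) (Inverse.to Φ y) xy)

  iso-G : Iso (mkGraph _ a′) G
  iso-G = Φ , λ _ _ → refl

  outcome : Simple G → ∀ {m} → edgeCount G ≡ m → G3Outcome m (G2 n T)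
  outcome simple-G edges-G = a′ , induced-simple (Inverse.to Φ) simple-G , old⊆a′ ,
    (λ x y xy _ → a′-covered x y xy) , trans (edgeCount-iso iso-G simple-G) edges-G

properties⇒inRange : ∀ ℓ m n G → Simple G × size G ≡ n × edgeCount G ≡ m × MinVCSize G ℓ → InRange ℓ m n G
properties⇒inRange ℓ m n G (simple-G , size-G , edges-G , S , min-S , ∣S∣≡ℓ) =
  parts , admissible (trans (sym (∣∣≡card S)) ∣S∣≡ℓ) edges-G , outcome simple-G edges-G , iso-G
  where
  min-s : IsMinCover (adj G) (lookup S)
  min-s = isMinVC⇒isMinCover G min-S
  H : CriticalSubgraph (adj G) (lookup S)
  H = criticalSubgraph simple-G min-s
  open CriticalSubgraph H using (simple; minCover; critical)
  open Reassembly size-G min-s H (decompose (size G) simple minCover critical)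

theorem3 : (ℓ m n : ℕ) (G : Graph) →
    (InRange ℓ m n G ⇔ (Simple G × size G ≡ n × edgeCount G ≡ m × MinVCSize G ℓ))
theorem3 ℓ m n G = mk⇔ (inRange⇒properties ℓ m n G) (properties⇒inRange ℓ m n G)
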